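{- Let $$P(x_1,x_2,x_3,x_4,y_1,y_2,y_3,y_4)=\sum_{i=1}^4 x_i^2y_i^2-4x_1x_2x_3x_4-4y_1y_2y_3y_4-2\sum_{1\le i<j\le 4}x_iy_ix_jy_j .$$ Let $x_2,x_3,x_4,y_1,y_2,y_3,y_4$ be rational numbers with $y_1\neq0$ such that $x_2x_3+y_1y_4$, $x_2x_4+y_1y_3$ and $x_3x_4+y_1y_2$ are each squares of rational numbers. Then the equation $P(x_1,x_2,x_3,x_4,y_1,y_2,y_3,y_4)=0$, viewed as a quadratic equation in $x_1$, has two rational roots (counted with multiplicity), and for each such root $x_1$ the quantities $x_1x_2+y_3y_4$, $x_1x_3+y_2y_4$ and $x_1x_4+y_2y_3$ are each squares of rational numbers.
   Context: Equivalently (via the identification of $P$ with Cayley's $2\times2\times2$ hyperdeterminant), this is a completion statement: from seven entries of a $2\times2\times2$ hypermatrix whose three complete faces have square (suitably signed) determinants, the eighth entry can be chosen rationally so that the other three face determinants are squares. -}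

module Defs where

open import Data.Rational using (ℚ; _+_; _*_; _-_; 0ℚ; 1ℚ)
open import Data.Product using (∃)
open import Relation.Binary.PropositionalEquality using (_≡_)

IsSquare : ℚ → Set
IsSquare q = ∃ λ r → q ≡ r * r

2ℚ 4ℚ : ℚ
2ℚ = 1ℚ + 1ℚ
4ℚ = 2ℚ + 2ℚ

P : ℚ → ℚ → ℚ → ℚ → ℚ → ℚ → ℚ → ℚ → ℚ
P x1 x2 x3 x4 y1 y2 y3 y4 =
  ((((x1 * x1 * (y1 * y1) + x2 * x2 * (y2 * y2))
      + x3 * x3 * (y3 * y3)) + x4 * x4 * (y4 * y4))
    - 4ℚ * (x1 * x2 * x3 * x4))
  - 4ℚ * (y1 * y2 * y3 * y4)
  - 2ℚ * (((((a1 * a2 + a1 * a3) + a1 * a4) + a2 * a3) + a2 * a4) + a3 * a4)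
  where
  a1 = x1 * y1
  a2 = x2 * y2
  a3 = x3 * y3
  a4 = x4 * y4

{-# OPTIONS --safe #-}
-- Let F₂, F₃, F₄ be the face determinants in the hypotheses and s₂, s₃, s₄ their square roots.
-- Completing the square in x1 gives  y1² P = (y1² x1 - centre)² - 4 F₂ F₃ F₄  with 4 F₂ F₃ F₄ = (2 s₂ s₃ s₄)²,
-- so P has the rational roots (centre ± 2 s₂ s₃ s₄) / y1². At such a root
--   y1² (x1 x2 + y3 y4) = x2 (y1² x1 - centre) + x2² F₂ + F₃ F₄ = (x2 s₂ ± s₃ s₄)²,
-- and symmetrically for x1 x3 + y2 y4 and x1 x4 + y2 y3; dividing by y1² keeps them squares.
module Submission where

open import Defs
open import Algebra.Properties.Group using (x∙y⁻¹≈ε⇒x≈y; inverseˡ-unique)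
open import Data.Product using (∃₂; _×_; _,_)
open import Data.Rational using (ℚ; _+_; _*_; _-_; 0ℚ; 1ℚ; -_; 1/_; NonZero; _≟_; ≢-nonZero)
open import Data.Rational.Properties
  using (*-identityˡ; *-identityʳ; *-zeroʳ; *-assoc; *-comm; *-inverseˡ; *-inverseʳ; +-inverseʳ; +-0-group)
open import Data.Rational.Solver using (module +-*-Solver)
open import Data.Sum using (_⊎_; inj₁; inj₂; [_,_]′; map)
open import Relation.Nullary using (yes; no)
open import Relation.Binary.PropositionalEquality
  using (_≡_; _≢_; refl; sym; trans; cong; cong₂; module ≡-Reasoning)

open +-*-Solver
open ≡-Reasoning

*-cancelˡ-≡ : ∀ p q r .{{_ : NonZero p}} → p * q ≡ p * r → q ≡ r
*-cancelˡ-≡ p q r pq≡pr = trans (sym (1/p*[p*x]≡x q)) (trans (cong (1/ p *_) pq≡pr) (1/p*[p*x]≡x r))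
  where
  1/p*[p*x]≡x : ∀ x → 1/ p * (p * x) ≡ x
  1/p*[p*x]≡x x = begin
    1/ p * (p * x)  ≡⟨ sym (*-assoc (1/ p) p x) ⟩
    1/ p * p * x    ≡⟨ cong (_* x) (*-inverseˡ p) ⟩
    1ℚ * x          ≡⟨ *-identityˡ x ⟩
    x               ∎

p*q≡0⇒p≡0∨q≡0 : ∀ p {q} → p * q ≡ 0ℚ → p ≡ 0ℚ ⊎ q ≡ 0ℚ
p*q≡0⇒p≡0∨q≡0 p {q} pq≡0 with p ≟ 0ℚ
... | yes p≡0 = inj₁ p≡0
... | no  p≢0 = inj₂ (*-cancelˡ-≡ p q 0ℚ {{≢-nonZero p≢0}} (trans pq≡0 (sym (*-zeroʳ p))))

p≢0⇒p*p≢0 : ∀ {p} → p ≢ 0ℚ → p * p ≢ 0ℚ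
p≢0⇒p*p≢0 {p} p≢0 pp≡0 = [ p≢0 , p≢0 ]′ (p*q≡0⇒p≡0∨q≡0 p pp≡0)

p*p≡q*q⇒p≡q∨p≡-q : ∀ p q → p * p ≡ q * q → p ≡ q ⊎ p ≡ - q
p*p≡q*q⇒p≡q∨p≡-q p q pp≡qq =
  map (x∙y⁻¹≈ε⇒x≈y +-0-group p q) (inverseˡ-unique +-0-group p q) (p*q≡0⇒p≡0∨q≡0 (p - q) (begin
    (p - q) * (p + q)  ≡⟨ solve 2 (λ p q → (p :- q) :* (p :+ q) := p :* p :- q :* q) refl p q ⟩
    p * p - q * q      ≡⟨ cong (_- q * q) pp≡qq ⟩
    q * q - q * q      ≡⟨ +-inverseʳ (q * q) ⟩
    0ℚ                 ∎))

IsSquare-cancelˡ : ∀ {t q} s → t ≢ 0ℚ → (t * t) * q ≡ s * s → IsSquare q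
IsSquare-cancelˡ {t} {q} s t≢0 ttq≡ss =
  s * 1/ t , *-cancelˡ-≡ (t * t) q _ {{≢-nonZero (p≢0⇒p*p≢0 t≢0)}} (begin
    (t * t) * q                          ≡⟨ ttq≡ss ⟩
    s * s                                ≡⟨ solve 1 (λ s → s :* s := con 1ℚ :* con 1ℚ :* (s :* s)) refl s ⟩
    1ℚ * 1ℚ * (s * s)                    ≡⟨ cong (λ e → e * e * (s * s)) (sym (*-inverseʳ t)) ⟩
    (t * 1/ t) * (t * 1/ t) * (s * s)    ≡⟨ solve 3 (λ t u s → (t :* u) :* (t :* u) :* (s :* s)
                                                       := (t :* t) :* ((s :* u) :* (s :* u))) refl t (1/ t) s ⟩
    (t * t) * ((s * 1/ t) * (s * 1/ t))  ∎)
  where instance _ = ≢-nonZero t≢0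

IsSquare-fromCompletedSquare : ∀ {t q δ F G H} x f g h → t ≢ 0ℚ →
  (t * t) * q ≡ x * δ + (x * x * F + G * H) →
  F ≡ f * f → G ≡ g * g → H ≡ h * h → δ ≡ 2ℚ * (f * (g * h)) → IsSquare q
IsSquare-fromCompletedSquare {t} {q} {δ} {F} {G} {H} x f g h t≢0 ttq≡ F≡ G≡ H≡ δ≡ =
  IsSquare-cancelˡ (x * f + g * h) t≢0 (begin
    (t * t) * q
      ≡⟨ ttq≡ ⟩
    x * δ + (x * x * F + G * H)
      ≡⟨ cong₂ (λ δ′ e → x * δ′ + e) δ≡ (cong₂ _+_ (cong (x * x *_) F≡) (cong₂ _*_ G≡ H≡)) ⟩
    x * (2ℚ * (f * (g * h))) + (x * x * (f * f) + (g * g) * (h * h))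
      ≡⟨ solve 4 (λ x f g h → x :* (con 2ℚ :* (f :* (g :* h))) :+ (x :* x :* (f :* f) :+ (g :* g) :* (h :* h))
                           := (x :* f :+ g :* h) :* (x :* f :+ g :* h)) refl x f g h ⟩
    (x * f + g * h) * (x * f + g * h)
      ∎)

quadratic-splits : ∀ {k} (f : ℚ → ℚ) m d → k ≢ 0ℚ →
  (∀ x → k * f x ≡ (k * x - m) * (k * x - m) - d * d) →
  ∃₂ λ r₁ r₂ → ∀ x → f x ≡ k * ((x - r₁) * (x - r₂))
quadratic-splits {k} f m d k≢0 completed = r₁ , r₂ , λ x → *-cancelˡ-≡ k (f x) _ (begin
    k * f x                              ≡⟨ completed x ⟩
    (k * x - m) * (k * x - m) - d * d    ≡⟨ solve 4 (λ k x m d → (k :* x :- m) :* (k :* x :- m) :- d :* d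
                                                       := (k :* x :- (m :+ d)) :* (k :* x :- (m :- d))) refl k x m d ⟩
    (k * x - (m + d)) * (k * x - (m - d)) ≡⟨ sym (cong₂ _*_ (scaled (m + d) x) (scaled (m - d) x)) ⟩
    (k * (x - r₁)) * (k * (x - r₂))      ≡⟨ solve 4 (λ k x r₁ r₂ → (k :* (x :- r₁)) :* (k :* (x :- r₂))
                                                       := k :* (k :* ((x :- r₁) :* (x :- r₂)))) refl k x r₁ r₂ ⟩
    k * (k * ((x - r₁) * (x - r₂)))      ∎)
  where
  instance _ = ≢-nonZero k≢0
  r₁ r₂ : ℚ
  r₁ = (m + d) * 1/ k
  r₂ = (m - d) * 1/ k
  scaled : ∀ p x → k * (x - p * 1/ k) ≡ k * x - p
  scaled p x = begin
    k * (x - p * 1/ k)      ≡⟨ solve 4 (λ k u p x → k :* (x :- p :* u) := k :* x :- p :* (k :* u)) refl k (1/ k) p x ⟩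
    k * x - p * (k * 1/ k)  ≡⟨ cong (λ e → k * x - p * e) (*-inverseʳ k) ⟩
    k * x - p * 1ℚ          ≡⟨ cong (λ e → k * x - e) (*-identityʳ p) ⟩
    k * x - p               ∎

root-of-completed-square : ∀ k m d x {v} → k * v ≡ (k * x - m) * (k * x - m) - d * d → v ≡ 0ℚ →
  k * x - m ≡ d ⊎ k * x - m ≡ - d
root-of-completed-square k m d x {v} completed v≡0 =
  p*p≡q*q⇒p≡q∨p≡-q (k * x - m) d (x∙y⁻¹≈ε⇒x≈y +-0-group _ _ (begin
    (k * x - m) * (k * x - m) - d * d  ≡⟨ sym completed ⟩
    k * v                              ≡⟨ cong (k *_) v≡0 ⟩
    k * 0ℚ                             ≡⟨ *-zeroʳ k ⟩
    0ℚ                                 ∎))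

module QuadraticInX1 (x2 x3 x4 y1 y2 y3 y4 : ℚ) where

  F₂ F₃ F₄ : ℚ
  F₂ = x3 * x4 + y1 * y2
  F₃ = x2 * x4 + y1 * y3
  F₄ = x2 * x3 + y1 * y4

  -- P x1 x2 x3 x4 y1 y2 y3 y4 = y1² x1² - 2 centre x1 + (terms free of x1)
  centre : ℚ
  centre = 2ℚ * (x2 * x3 * x4) + y1 * (x2 * y2 + x3 * y3 + x4 * y4)

  P-completed-square : ∀ x1 →
    (y1 * y1) * P x1 x2 x3 x4 y1 y2 y3 y4
      ≡ ((y1 * y1) * x1 - centre) * ((y1 * y1) * x1 - centre) - 4ℚ * (F₂ * F₃ * F₄)
  P-completed-square x1 = solve 8 (λ x1 x2 x3 x4 y1 y2 y3 y4 →
    let a1 = x1 :* y1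
        a2 = x2 :* y2
        a3 = x3 :* y3
        a4 = x4 :* y4
        m  = con 2ℚ :* (x2 :* x3 :* x4) :+ y1 :* (x2 :* y2 :+ x3 :* y3 :+ x4 :* y4)
        δ  = y1 :* y1 :* x1 :- m
    in (y1 :* y1) :*
       (((((x1 :* x1 :* (y1 :* y1) :+ x2 :* x2 :* (y2 :* y2))
             :+ x3 :* x3 :* (y3 :* y3)) :+ x4 :* x4 :* (y4 :* y4))
           :- con 4ℚ :* (x1 :* x2 :* x3 :* x4))
         :- con 4ℚ :* (y1 :* y2 :* y3 :* y4)
         :- con 2ℚ :* (((((a1 :* a2 :+ a1 :* a3) :+ a1 :* a4) :+ a2 :* a3) :+ a2 :* a4) :+ a3 :* a4))
       := δ :* δ :- con 4ℚ :* ((x3 :* x4 :+ y1 :* y2) :* (x2 :* x4 :+ y1 :* y3) :* (x2 :* x3 :+ y1 :* y4)))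
    refl x1 x2 x3 x4 y1 y2 y3 y4

  P-difference-of-squares : ∀ s₂ s₃ s₄ → F₂ ≡ s₂ * s₂ → F₃ ≡ s₃ * s₃ → F₄ ≡ s₄ * s₄ → ∀ x1 →
    (y1 * y1) * P x1 x2 x3 x4 y1 y2 y3 y4
      ≡ ((y1 * y1) * x1 - centre) * ((y1 * y1) * x1 - centre) - (2ℚ * (s₂ * s₃ * s₄)) * (2ℚ * (s₂ * s₃ * s₄))
  P-difference-of-squares s₂ s₃ s₄ F₂≡ F₃≡ F₄≡ x1 =
    trans (P-completed-square x1) (cong (λ e → ((y1 * y1) * x1 - centre) * ((y1 * y1) * x1 - centre) - e) (begin
      4ℚ * (F₂ * F₃ * F₄)                            ≡⟨ cong (4ℚ *_) (cong₂ _*_ (cong₂ _*_ F₂≡ F₃≡) F₄≡) ⟩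
      4ℚ * (s₂ * s₂ * (s₃ * s₃) * (s₄ * s₄))         ≡⟨ solve 3 (λ s₂ s₃ s₄ →
                                                           con 4ℚ :* (s₂ :* s₂ :* (s₃ :* s₃) :* (s₄ :* s₄))
                                                           := (con 2ℚ :* (s₂ :* s₃ :* s₄)) :* (con 2ℚ :* (s₂ :* s₃ :* s₄)))
                                                         refl s₂ s₃ s₄ ⟩
      (2ℚ * (s₂ * s₃ * s₄)) * (2ℚ * (s₂ * s₃ * s₄))  ∎))

  P-splits : y1 ≢ 0ℚ → ∀ s₂ s₃ s₄ → F₂ ≡ s₂ * s₂ → F₃ ≡ s₃ * s₃ → F₄ ≡ s₄ * s₄ →
    ∃₂ λ r1 r2 → ∀ x1 → P x1 x2 x3 x4 y1 y2 y3 y4 ≡ (y1 * y1) * ((x1 - r1) * (x1 - r2))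
  P-splits y1≢0 s₂ s₃ s₄ F₂≡ F₃≡ F₄≡ =
    quadratic-splits (λ x1 → P x1 x2 x3 x4 y1 y2 y3 y4) centre (2ℚ * (s₂ * s₃ * s₄))
      (p≢0⇒p*p≢0 y1≢0) (P-difference-of-squares s₂ s₃ s₄ F₂≡ F₃≡ F₄≡)

  P-roots : ∀ s₂ s₃ s₄ → F₂ ≡ s₂ * s₂ → F₃ ≡ s₃ * s₃ → F₄ ≡ s₄ * s₄ → ∀ x1 → P x1 x2 x3 x4 y1 y2 y3 y4 ≡ 0ℚ →
    (y1 * y1) * x1 - centre ≡ 2ℚ * (s₂ * s₃ * s₄) ⊎ (y1 * y1) * x1 - centre ≡ - (2ℚ * (s₂ * s₃ * s₄))
  P-roots s₂ s₃ s₄ F₂≡ F₃≡ F₄≡ x1 =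
    root-of-completed-square (y1 * y1) centre (2ℚ * (s₂ * s₃ * s₄)) x1
      (P-difference-of-squares s₂ s₃ s₄ F₂≡ F₃≡ F₄≡ x1)

  scaled-x1x2+y3y4 : ∀ x1 →
    (y1 * y1) * (x1 * x2 + y3 * y4) ≡ x2 * ((y1 * y1) * x1 - centre) + (x2 * x2 * F₂ + F₃ * F₄)
  scaled-x1x2+y3y4 x1 = solve 8 (λ x1 x2 x3 x4 y1 y2 y3 y4 →
    (y1 :* y1) :* (x1 :* x2 :+ y3 :* y4)
    := x2 :* ((y1 :* y1) :* x1 :- (con 2ℚ :* (x2 :* x3 :* x4) :+ y1 :* (x2 :* y2 :+ x3 :* y3 :+ x4 :* y4)))
       :+ (x2 :* x2 :* (x3 :* x4 :+ y1 :* y2) :+ (x2 :* x4 :+ y1 :* y3) :* (x2 :* x3 :+ y1 :* y4)))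
    refl x1 x2 x3 x4 y1 y2 y3 y4

  scaled-x1x3+y2y4 : ∀ x1 →
    (y1 * y1) * (x1 * x3 + y2 * y4) ≡ x3 * ((y1 * y1) * x1 - centre) + (x3 * x3 * F₃ + F₂ * F₄)
  scaled-x1x3+y2y4 x1 = solve 8 (λ x1 x2 x3 x4 y1 y2 y3 y4 →
    (y1 :* y1) :* (x1 :* x3 :+ y2 :* y4)
    := x3 :* ((y1 :* y1) :* x1 :- (con 2ℚ :* (x2 :* x3 :* x4) :+ y1 :* (x2 :* y2 :+ x3 :* y3 :+ x4 :* y4)))
       :+ (x3 :* x3 :* (x2 :* x4 :+ y1 :* y3) :+ (x3 :* x4 :+ y1 :* y2) :* (x2 :* x3 :+ y1 :* y4)))
    refl x1 x2 x3 x4 y1 y2 y3 y4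

  scaled-x1x4+y2y3 : ∀ x1 →
    (y1 * y1) * (x1 * x4 + y2 * y3) ≡ x4 * ((y1 * y1) * x1 - centre) + (x4 * x4 * F₄ + F₂ * F₃)
  scaled-x1x4+y2y3 x1 = solve 8 (λ x1 x2 x3 x4 y1 y2 y3 y4 →
    (y1 :* y1) :* (x1 :* x4 :+ y2 :* y3)
    := x4 :* ((y1 :* y1) :* x1 :- (con 2ℚ :* (x2 :* x3 :* x4) :+ y1 :* (x2 :* y2 :+ x3 :* y3 :+ x4 :* y4)))
       :+ (x4 :* x4 :* (x2 :* x3 :+ y1 :* y4) :+ (x3 :* x4 :+ y1 :* y2) :* (x2 :* x4 :+ y1 :* y3)))
    refl x1 x2 x3 x4 y1 y2 y3 y4

  squares-at-root : y1 ≢ 0ℚ → ∀ s₂ s₃ s₄ → F₂ ≡ s₂ * s₂ → F₃ ≡ s₃ * s₃ → F₄ ≡ s₄ * s₄ →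
    ∀ x1 → (y1 * y1) * x1 - centre ≡ 2ℚ * (s₂ * s₃ * s₄) →
    IsSquare (x1 * x2 + y3 * y4) × IsSquare (x1 * x3 + y2 * y4) × IsSquare (x1 * x4 + y2 * y3)
  squares-at-root y1≢0 s₂ s₃ s₄ F₂≡ F₃≡ F₄≡ x1 root =
      IsSquare-fromCompletedSquare x2 s₂ s₃ s₄ y1≢0 (scaled-x1x2+y3y4 x1) F₂≡ F₃≡ F₄≡
        (trans root (cong (2ℚ *_) (*-assoc s₂ s₃ s₄)))
    , IsSquare-fromCompletedSquare x3 s₃ s₂ s₄ y1≢0 (scaled-x1x3+y2y4 x1) F₃≡ F₂≡ F₄≡
        (trans root (cong (2ℚ *_) (trans (cong (_* s₄) (*-comm s₂ s₃)) (*-assoc s₃ s₂ s₄))))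
    , IsSquare-fromCompletedSquare x4 s₄ s₂ s₃ y1≢0 (scaled-x1x4+y2y3 x1) F₄≡ F₂≡ F₃≡
        (trans root (cong (2ℚ *_) (*-comm (s₂ * s₃) s₄)))

  -- Replacing s₂ by - s₂ exchanges the two roots.
  squares-at-roots : y1 ≢ 0ℚ → ∀ s₂ s₃ s₄ → F₂ ≡ s₂ * s₂ → F₃ ≡ s₃ * s₃ → F₄ ≡ s₄ * s₄ →
    ∀ x1 → (y1 * y1) * x1 - centre ≡ 2ℚ * (s₂ * s₃ * s₄) ⊎ (y1 * y1) * x1 - centre ≡ - (2ℚ * (s₂ * s₃ * s₄)) →
    IsSquare (x1 * x2 + y3 * y4) × IsSquare (x1 * x3 + y2 * y4) × IsSquare (x1 * x4 + y2 * y3)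
  squares-at-roots y1≢0 s₂ s₃ s₄ F₂≡ F₃≡ F₄≡ x1 (inj₁ root) = squares-at-root y1≢0 s₂ s₃ s₄ F₂≡ F₃≡ F₄≡ x1 root
  squares-at-roots y1≢0 s₂ s₃ s₄ F₂≡ F₃≡ F₄≡ x1 (inj₂ root) =
    squares-at-root y1≢0 (- s₂) s₃ s₄
      (trans F₂≡ (solve 1 (λ s → s :* s := (:- s) :* (:- s)) refl s₂)) F₃≡ F₄≡ x1
      (trans root (solve 3 (λ s₂ s₃ s₄ → :- (con 2ℚ :* (s₂ :* s₃ :* s₄)) := con 2ℚ :* ((:- s₂) :* s₃ :* s₄))
                    refl s₂ s₃ s₄))

mainTheorem3 : (x2 x3 x4 y1 y2 y3 y4 : ℚ) → y1 ≢ 0ℚ →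
    IsSquare (x2 * x3 + y1 * y4) →
    IsSquare (x2 * x4 + y1 * y3) →
    IsSquare (x3 * x4 + y1 * y2) →
    -- the quadratic in x1 (leading coefficient y1²) splits over ℚ with roots r1, r2
    (∃₂ λ r1 r2 → ∀ x1 → P x1 x2 x3 x4 y1 y2 y3 y4 ≡ (y1 * y1) * ((x1 - r1) * (x1 - r2)))
    ×
    -- every rational root x1 yields the three further squares
    (∀ x1 → P x1 x2 x3 x4 y1 y2 y3 y4 ≡ 0ℚ →
      IsSquare (x1 * x2 + y3 * y4) ×
      IsSquare (x1 * x3 + y2 * y4) ×
      IsSquare (x1 * x4 + y2 * y3))
mainTheorem3 x2 x3 x4 y1 y2 y3 y4 y1≢0 (s₄ , F₄≡) (s₃ , F₃≡) (s₂ , F₂≡) =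
    P-splits y1≢0 s₂ s₃ s₄ F₂≡ F₃≡ F₄≡
  , λ x1 P≡0 → squares-at-roots y1≢0 s₂ s₃ s₄ F₂≡ F₃≡ F₄≡ x1 (P-roots s₂ s₃ s₄ F₂≡ F₃≡ F₄≡ x1 P≡0)
  where open QuadraticInX1 x2 x3 x4 y1 y2 y3 y4
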